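{- Let $\mathcal{M}=(Q,r)$ be a matroid and let $X,Y\subseteq Q$ be flats of $\mathcal{M}$. If a quasi-intersection of $(X,Y)$ exists, then it is unique; that is, if $T_1,T_2\subseteq Q$ are both quasi-intersections of $(X,Y)$, then $T_1=T_2$.
   Context: For a matroid $(Q,r)$ and $A,B\subseteq Q$ write $AB=A\cup B$ and $r(A|B)=r(AB)-r(B)$. A flat is a set $F\subseteq Q$ with $r(Fx)>r(F)$ for all $x\in Q\setminus F$. A quasi-intersection of the pair of flats $(X,Y)$ is a flat $T\subseteq Q$ such that (DL1) $r(T|X)=0$, and (DL2) for every flat $X'\subseteq X$: $r(T|X')=0$ if and only if $r(Y|X')=r(Y|X)$. -}

module Defs where

open import Data.Nat using (ℕ; _≤_; _+_; _∸_; _<_)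
open import Data.Fin using (Fin)
open import Data.Fin.Subset using (Subset; _∪_; _∩_; _⊆_; _∈_; _∉_; ∣_∣; ⁅_⁆)
open import Relation.Binary.PropositionalEquality using (_≡_)
open import Data.Product using (_×_)
open import Function.Bundles using (_⇔_)

record Matroid (n : ℕ) : Set where
  field
    r          : Subset n → ℕ
    r-bounded  : ∀ A → r A ≤ ∣ A ∣
    r-mono     : ∀ {A B} → A ⊆ B → r A ≤ r B
    r-submod   : ∀ A B → r (A ∪ B) + r (A ∩ B) ≤ r A + r B

module _ {n : ℕ} (M : Matroid n) where
  open Matroid M

  -- r(A|B) = r(AB) - r(B)   (truncated subtraction is exact by monotonicity)
  rc : Subset n → Subset n → ℕ
  rc A B = r (A ∪ B) ∸ r B

  IsFlat : Subset n → Set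
  IsFlat F = ∀ x → x ∉ F → r F < r (F ∪ ⁅ x ⁆)

  IsQuasiIntersection : Subset n → Subset n → Subset n → Set
  IsQuasiIntersection X Y T =
    IsFlat T
    × rc T X ≡ 0
    × (∀ X′ → IsFlat X′ → X′ ⊆ X → (rc T X′ ≡ 0 ⇔ rc Y X′ ≡ rc Y X))

{-# OPTIONS --safe #-}
module Submission where

open import Defs
open import Data.Nat using (ℕ; _<_)
open import Data.Nat.Properties using (m∸n≡0⇒m≤n; n∸n≡0; <-irrefl; module ≤-Reasoning)
open import Data.Fin.Subset using (Subset; _∪_; _⊆_; _∈_; ⁅_⁆)
open import Data.Fin.Subset.Properties using (_∈?_; ⊆-antisym; ∪-idem; x∈p∪q⁻; p⊆p∪q; q⊆p∪q; x∈⁅y⁆⇒x≡y)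
open import Data.Sum using (inj₁; inj₂)
open import Data.Product using (_,_)
open import Data.Empty using (⊥-elim)
open import Relation.Nullary using (yes; no)
open import Relation.Binary.PropositionalEquality using (_≡_; refl; sym; subst)
open import Function.Bundles using (Equivalence)

-- A quasi-intersection T of (X, Y) lies in X because X is a flat.  Applying
-- (DL2) for T₂ at X′ = T₂ gives r(Y|T₂) = r(Y|X); (DL2) for T₁ at the same X′
-- then gives r(T₁|T₂) = 0, so T₁ ⊆ T₂ because T₂ is a flat.  By symmetry T₁ = T₂.

module _ {n : ℕ} (M : Matroid n) where
  open Matroid M

  rc-refl : ∀ A → rc M A A ≡ 0
  rc-refl A rewrite ∪-idem A = n∸n≡0 (r A)

  flat-rc≡0⇒⊆ : ∀ {A F} → IsFlat M F → rc M A F ≡ 0 → A ⊆ F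
  flat-rc≡0⇒⊆ {A} {F} F-flat rcAF≡0 {x} x∈A with x ∈? F
  ... | yes x∈F = x∈F
  ... | no  x∉F = ⊥-elim (<-irrefl refl rF<rF)
    where
    F∪⁅x⁆⊆A∪F : F ∪ ⁅ x ⁆ ⊆ A ∪ F
    F∪⁅x⁆⊆A∪F y∈F∪⁅x⁆ with x∈p∪q⁻ F ⁅ x ⁆ y∈F∪⁅x⁆
    ... | inj₁ y∈F    = q⊆p∪q A F y∈F
    ... | inj₂ y∈⁅x⁆ = subst (_∈ A ∪ F) (sym (x∈⁅y⁆⇒x≡y x y∈⁅x⁆)) (p⊆p∪q F x∈A)

    open ≤-Reasoning
    rF<rF : r F < r F
    rF<rF = begin-strict
      r F           <⟨ F-flat x x∉F ⟩
      r (F ∪ ⁅ x ⁆) ≤⟨ r-mono F∪⁅x⁆⊆A∪F ⟩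
      r (A ∪ F)     ≤⟨ m∸n≡0⇒m≤n rcAF≡0 ⟩
      r F           ∎

  quasiIntersection⊆ : ∀ {X Y T} → IsFlat M X → IsQuasiIntersection M X Y T → T ⊆ X
  quasiIntersection⊆ X-flat (_ , rcTX≡0 , _) = flat-rc≡0⇒⊆ X-flat rcTX≡0

  quasiIntersection-⊆ : ∀ {X Y T₁ T₂} → IsFlat M X →
    IsQuasiIntersection M X Y T₁ → IsQuasiIntersection M X Y T₂ → T₁ ⊆ T₂
  quasiIntersection-⊆ {X} {Y} {T₂ = T₂} X-flat (_ , _ , dl2₁) qi₂@(T₂-flat , _ , dl2₂) =
    flat-rc≡0⇒⊆ T₂-flat (Equivalence.from (dl2₁ T₂ T₂-flat T₂⊆X) rcYT₂≡rcYX)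
    where
    T₂⊆X : T₂ ⊆ X
    T₂⊆X = quasiIntersection⊆ X-flat qi₂

    rcYT₂≡rcYX : rc M Y T₂ ≡ rc M Y X
    rcYT₂≡rcYX = Equivalence.to (dl2₂ T₂ T₂-flat T₂⊆X) (rc-refl T₂)

lemma3p3 : {n : ℕ} (M : Matroid n) (X Y T₁ T₂ : Subset n) →
    IsFlat M X → IsFlat M Y →
    IsQuasiIntersection M X Y T₁ → IsQuasiIntersection M X Y T₂ →
    T₁ ≡ T₂
lemma3p3 M X Y T₁ T₂ X-flat _ qi₁ qi₂ =
  ⊆-antisym (quasiIntersection-⊆ M X-flat qi₁ qi₂) (quasiIntersection-⊆ M X-flat qi₂ qi₁)
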